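{- Let $v\le w$ in the middle order $\mathcal{P}_n$, with $I(v)=(x_1,\ldots,x_n)$ and $I(w)=(y_1,\ldots,y_n)$. The interval $[v,w]$ is boolean if and only if $y_i\in\{x_i,x_i+1\}$ for all $i$. Moreover, a boolean interval $[v,w]$ has rank $k$ if and only if there are exactly $k$ indices $i$ with $y_i=x_i+1$. Consequently, every boolean interval in $\mathcal{P}_n$ has rank at most $n-1$.
   Context: For $w\in S_n$ (one-line notation), its inversion sequence is $I(w)=(x_1,\ldots,x_n)$ with $x_i=\#\{j<i : w^{ -1}(j)>w^{ -1}(i)\}$. The middle order $\mathcal{P}_n$ is the poset on $S_n$ with $v\le w$ iff $I(v)\le I(w)$ coordinate-wise; it is graded with rank of $w$ equal to the sum of entries of $I(w)$, and the rank of $[v,w]$ is $r(w)-r(v)$. An interval is boolean if it is isomorphic (as a poset) to a boolean algebra (the lattice of subsets of a finite set). -}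

module Defs where

open import Data.Nat using (ℕ; zero; suc; _+_; _≤_; _∸_)
open import Data.Nat.Properties using (_≟_)
open import Data.Fin using (Fin; _<?_)
open import Data.Fin.Permutation using (Permutation′; _⟨$⟩ʳ_; _⟨$⟩ˡ_)
open import Data.Fin.Subset using (Subset; _⊆_)
open import Data.List using (List; length; filter; map; allFin)
open import Data.Nat.ListAction using (sum)
open import Data.Product using (Σ; ∃; _×_; _,_; proj₁)
open import Relation.Nullary.Decidable using (_×-dec_)
open import Relation.Binary.PropositionalEquality using (_≡_)
open import Function.Bundles using (_⇔_)

-- S_n : permutations of Fin n (0-based); w ⟨$⟩ʳ i is w(i) in one-line
-- notation, w ⟨$⟩ˡ j is w⁻¹(j).
Perm : ℕ → Set
Perm n = Permutation′ n

I : ∀ {n} → Perm n → Fin n → ℕ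
I {n} w i = length (filter (λ j → (j <? i) ×-dec ((w ⟨$⟩ˡ i) <? (w ⟨$⟩ˡ j))) (allFin n))

_≤M_ : ∀ {n} → Perm n → Perm n → Set
v ≤M w = ∀ i → I v i ≤ I w i

_≈P_ : ∀ {n} → Perm n → Perm n → Set
u ≈P u' = ∀ i → (u ⟨$⟩ʳ i) ≡ (u' ⟨$⟩ʳ i)

rank : ∀ {n} → Perm n → ℕ
rank {n} w = sum (map (I w) (allFin n))

intervalRank : ∀ {n} → Perm n → Perm n → ℕ
intervalRank v w = rank w ∸ rank v

Interval : ∀ {n} → Perm n → Perm n → Set
Interval v w = Σ (Perm _) (λ u → (v ≤M u) × (u ≤M w))

record IsBoolIso {n} (v w : Perm n) (m : ℕ) (f : Interval v w → Subset m) : Set where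
  field
    injective  : ∀ a b → f a ≡ f b → proj₁ a ≈P proj₁ b
    surjective : ∀ (s : Subset m) → Σ (Interval v w) (λ a → f a ≡ s)
    order      : ∀ a b → (proj₁ a ≤M proj₁ b) ⇔ (f a ⊆ f b)

IsBoolean : ∀ {n} → Perm n → Perm n → Set
IsBoolean {n} v w = Σ ℕ (λ m → Σ (Interval v w → Subset m) (IsBoolIso v w m))

numUp : ∀ {n} → Perm n → Perm n → ℕ
numUp {n} v w = length (filter (λ i → I w i ≟ suc (I v i)) (allFin n))

-- The inversion sequence is the Lehmer code of w⁻¹, so I is a bijection from S_n onto the codes
-- c with c_i ≤ i (peel off the last position of w⁻¹ and recurse); hence [v,w] is isomorphic to
-- the box of codes between x = I(v) and y = I(w), ordered coordinatewise. When every y_i is x_i or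
-- x_i + 1, that box is the boolean lattice on the coordinates with y_i = x_i + 1, and its rank is
-- their number. When y_i ≥ x_i + 2, the codes x < x + e_i < x + 2e_i span a chain in which every
-- element between the ends is comparable with the middle one, which cannot happen in a boolean
-- lattice: A ∪ (C ─ B) lies between A and C and is incomparable with B. Since y_1 = 0, at most
-- n − 1 coordinates can be raised.
module Submission where

open import Defs
open import Data.Bool using (Bool; true; false; _∧_; if_then_else_)
open import Data.Fin as Fin using (Fin; zero; suc; toℕ; fromℕ; fromℕ<; inject₁; punchIn; _<?_)
open import Data.Fin.Permutation
  using (Permutation; Permutation′; id; flip; _⟨$⟩ʳ_; _⟨$⟩ˡ_; remove; insert; inverseˡ; inverseʳ;
         punchIn-permute; remove-insert)
import Data.Fin.Properties as Fin
open import Data.Fin.Relation.Unary.Top using (view; ‵fromℕ; ‵inject₁)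
open import Data.Fin.Subset using (Subset; _⊆_; _∈_; _∉_; _∪_; _─_; ∣_∣; inside; outside)
open import Data.Fin.Subset.Properties
  using (_∈?_; ⊆-antisym; ⊆-reflexive; drop-there; drop-∷-⊆; p⊆p∪q; q⊆p∪q; x∈p∪q⁻; p─q⊆p;
         x∈p∧x∉q⇒x∈p─q)
open import Data.List using ([]; _∷_; map; length; filter; tabulate; allFin)
open import Data.List.Properties using (filter-accept; filter-reject; length-filter; length-tabulate)
open import Data.Nat using (ℕ; zero; suc; _+_; _∸_; _≤_; _<_; z≤n; s≤s; s≤s⁻¹)
open import Data.Nat.ListAction using (sum)
import Data.Nat.Properties as ℕ
open import Algebra.Properties.CommutativeMonoid.Sum ℕ.+-0-commutativeMonoid
  using (sum-remove; sum-permute; sum-cong-≗; sum-syntax)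
open import Data.Product using (Σ; _×_; _,_; proj₁; proj₂)
open import Data.Sum as Sum using (_⊎_; inj₁; inj₂; [_,_]; [_,_]′)
open import Data.Vec using ([]; _∷_; here; there)
open import Data.Vec.Functional using (updateAt)
open import Data.Vec.Functional.Properties using (updateAt-updates; updateAt-minimal)
open import Data.Vec.Functional.Relation.Binary.Pointwise using (Pointwise)
open import Function.Base using (_∘_)
open import Function.Bundles using (_⇔_; mk⇔; Equivalence)
import Function.Properties.Equivalence as ⇔
open import Relation.Binary.PropositionalEquality hiding ([_])
open import Relation.Nullary using (¬_; Dec; does; yes; no; contradiction)
open import Relation.Nullary.Decidable using (_×-dec_; dec-true; dec-false; does-⇔; decidable-stable)
open import Relation.Unary using (Pred; Decidable)

open Equivalence using (to; from)

indicator : Bool → ℕ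
indicator true  = 1
indicator false = 0

count : ∀ n → (Fin n → Bool) → ℕ
count n f = ∑[ j < n ] indicator (f j)

count-cong : ∀ {n} {f g : Fin n → Bool} → (∀ j → f j ≡ g j) → count n f ≡ count n g
count-cong f≗g = sum-cong-≗ (cong indicator ∘ f≗g)

count-remove : ∀ {n} (i : Fin (suc n)) (f : Fin (suc n) → Bool) →
  count (suc n) f ≡ indicator (f i) + count n (f ∘ punchIn i)
count-remove i f = sum-remove {i = i} (indicator ∘ f)

count-permute : ∀ {n} (π : Permutation′ n) (f : Fin n → Bool) → count n (f ∘ (π ⟨$⟩ʳ_)) ≡ count n f
count-permute π f = sym (sum-permute (indicator ∘ f) π)

count-≤toℕ : ∀ n m → count n (λ k → does (m ℕ.≤? toℕ k)) ≡ n ∸ m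
count-≤toℕ zero    m       = sym (ℕ.0∸n≡0 m)
count-≤toℕ (suc n) zero    = cong suc (count-≤toℕ n zero)
count-≤toℕ (suc n) (suc m) = trans
  (count-cong {n} λ k → does-⇔ (mk⇔ s≤s⁻¹ s≤s) (suc m ℕ.≤? suc (toℕ k)) (m ℕ.≤? toℕ k))
  (count-≤toℕ n m)

length-filter-tabulate : ∀ {a p} {A : Set a} {P : Pred A p} (P? : Decidable P) {n} (g : Fin n → A) →
  length (filter P? (tabulate g)) ≡ count n (does ∘ P? ∘ g)
length-filter-tabulate P? {zero}  g = refl
length-filter-tabulate P? {suc n} g with does (P? (g zero))
... | true  = cong suc (length-filter-tabulate P? (g ∘ suc))
... | false = length-filter-tabulate P? (g ∘ suc)

-- Lehmer codes

punchIn-fromℕ : ∀ {n} (j : Fin n) → punchIn (fromℕ n) j ≡ inject₁ j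
punchIn-fromℕ zero    = refl
punchIn-fromℕ (suc j) = cong suc (punchIn-fromℕ j)

inject₁<fromℕ : ∀ {n} (j : Fin n) → toℕ (inject₁ j) < toℕ (fromℕ n)
inject₁<fromℕ {n} j = subst (toℕ (inject₁ j) <_) (sym (Fin.toℕ-fromℕ n)) (Fin.inject₁ℕ< j)

punchIn-<-⇔ : ∀ {n} (i : Fin (suc n)) {j k : Fin n} →
  toℕ (punchIn i j) < toℕ (punchIn i k) ⇔ toℕ j < toℕ k
punchIn-<-⇔ i {j} {k} = mk⇔
  (λ j<k → ℕ.≰⇒> (ℕ.<⇒≱ j<k ∘ Fin.punchIn-mono-≤ i k j))
  (λ j<k → ℕ.≰⇒> (ℕ.<⇒≱ j<k ∘ Fin.punchIn-cancel-≤ i k j))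

<punchIn-⇔ : ∀ {n} (i : Fin (suc n)) (k : Fin n) → toℕ i < toℕ (punchIn i k) ⇔ toℕ i ≤ toℕ k
<punchIn-⇔ i k = mk⇔ (<punchIn⇒≤ i k) (≤⇒<punchIn i k)
  where
  <punchIn⇒≤ : ∀ {n} (i : Fin (suc n)) (k : Fin n) → toℕ i < toℕ (punchIn i k) → toℕ i ≤ toℕ k
  <punchIn⇒≤ zero    k       _         = z≤n
  <punchIn⇒≤ (suc i) (suc k) (s≤s i<k) = s≤s (<punchIn⇒≤ i k i<k)
  ≤⇒<punchIn : ∀ {n} (i : Fin (suc n)) (k : Fin n) → toℕ i ≤ toℕ k → toℕ i < toℕ (punchIn i k)
  ≤⇒<punchIn zero    k       _         = s≤s z≤n
  ≤⇒<punchIn (suc i) (suc k) (s≤s i≤k) = s≤s (≤⇒<punchIn i k i≤k)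

insert-self : ∀ {m n} i j (π : Permutation m n) → insert i j π ⟨$⟩ʳ i ≡ j
insert-self i j π with i Fin.≟ i
... | yes _   = refl
... | no  i≢i = contradiction refl i≢i

inversions : ∀ {n} → Permutation′ n → Fin n → ℕ
inversions {n} σ i = count n (λ j → does (j <? i) ∧ does (σ ⟨$⟩ʳ i <? σ ⟨$⟩ʳ j))

module _ {n} (σ : Permutation′ (suc n)) where
  private
    top = fromℕ n
    τ   = remove top σ
    p   = σ ⟨$⟩ʳ top

    σ-punchIn : ∀ j → σ ⟨$⟩ʳ punchIn top j ≡ punchIn p (τ ⟨$⟩ʳ j)
    σ-punchIn = punchIn-permute σ top

    before-top : ∀ j → toℕ (punchIn top j) < toℕ top
    before-top j = subst (λ k → toℕ k < toℕ top) (sym (punchIn-fromℕ j)) (inject₁<fromℕ j)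

  permute-inject₁ : ∀ j → σ ⟨$⟩ʳ inject₁ j ≡ punchIn p (τ ⟨$⟩ʳ j)
  permute-inject₁ j = trans (cong (σ ⟨$⟩ʳ_) (sym (punchIn-fromℕ j))) (σ-punchIn j)

  inversions-fromℕ : inversions σ top ≡ n ∸ toℕ p
  inversions-fromℕ = begin
    inversions σ top
      ≡⟨ count-remove top (λ j → does (j <? top) ∧ does (p <? σ ⟨$⟩ʳ j)) ⟩
    indicator (does (top <? top) ∧ does (p <? p))
      + count n (λ j → does (punchIn top j <? top) ∧ does (p <? σ ⟨$⟩ʳ punchIn top j))
      ≡⟨ cong₂ _+_ (cong (λ b → indicator (b ∧ does (p <? p)))
                         (dec-false (top <? top) (ℕ.<-irrefl refl)))
                   (count-cong {n} λ j → cong₂ _∧_ (dec-true (punchIn top j <? top) (before-top j))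
                                                  (above j)) ⟩
    count n (λ j → does (toℕ p ℕ.≤? toℕ (τ ⟨$⟩ʳ j)))
      ≡⟨ count-permute τ (λ k → does (toℕ p ℕ.≤? toℕ k)) ⟩
    count n (λ k → does (toℕ p ℕ.≤? toℕ k))
      ≡⟨ count-≤toℕ n (toℕ p) ⟩
    n ∸ toℕ p ∎
    where
    open ≡-Reasoning
    above : ∀ j → does (p <? σ ⟨$⟩ʳ punchIn top j) ≡ does (toℕ p ℕ.≤? toℕ (τ ⟨$⟩ʳ j))
    above j = trans (cong (does ∘ (p <?_)) (σ-punchIn j))
      (does-⇔ (<punchIn-⇔ p (τ ⟨$⟩ʳ j)) (p <? punchIn p (τ ⟨$⟩ʳ j)) (toℕ p ℕ.≤? toℕ (τ ⟨$⟩ʳ j)))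

  inversions-inject₁ : ∀ i → inversions σ (inject₁ i) ≡ inversions τ i
  inversions-inject₁ i = begin
    inversions σ (inject₁ i)
      ≡⟨ cong (inversions σ) (sym (punchIn-fromℕ i)) ⟩
    inversions σ i′
      ≡⟨ count-remove top (λ j → does (j <? i′) ∧ does (σ ⟨$⟩ʳ i′ <? σ ⟨$⟩ʳ j)) ⟩
    indicator (does (top <? i′) ∧ does (σ ⟨$⟩ʳ i′ <? p))
      + count n (λ j → does (punchIn top j <? i′) ∧ does (σ ⟨$⟩ʳ i′ <? σ ⟨$⟩ʳ punchIn top j))
      ≡⟨ cong₂ _+_ (cong (λ b → indicator (b ∧ does (σ ⟨$⟩ʳ i′ <? p)))
                         (dec-false (top <? i′) (ℕ.<-asym (before-top i))))
                   (count-cong {n} λ j → cong₂ _∧_ (earlier j) (later j)) ⟩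
    inversions τ i ∎
    where
    open ≡-Reasoning
    i′ = punchIn top i
    earlier : ∀ j → does (punchIn top j <? i′) ≡ does (j <? i)
    earlier j = does-⇔ (punchIn-<-⇔ top) (punchIn top j <? i′) (j <? i)
    later : ∀ j → does (σ ⟨$⟩ʳ i′ <? σ ⟨$⟩ʳ punchIn top j) ≡ does (τ ⟨$⟩ʳ i <? τ ⟨$⟩ʳ j)
    later j = trans (cong₂ (λ a b → does (a <? b)) (σ-punchIn i) (σ-punchIn j))
      (does-⇔ (punchIn-<-⇔ p) (punchIn p (τ ⟨$⟩ʳ i) <? punchIn p (τ ⟨$⟩ʳ j)) (τ ⟨$⟩ʳ i <? τ ⟨$⟩ʳ j))

inversions-cong : ∀ {n} {σ σ′ : Permutation′ n} → (∀ i → σ ⟨$⟩ʳ i ≡ σ′ ⟨$⟩ʳ i) →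
  ∀ i → inversions σ i ≡ inversions σ′ i
inversions-cong {n} σ≗σ′ i = count-cong {n} λ j →
  cong₂ (λ a b → does (j <? i) ∧ does (a <? b)) (σ≗σ′ i) (σ≗σ′ j)

inversions-≤ : ∀ {n} (σ : Permutation′ n) i → inversions σ i ≤ toℕ i
inversions-≤ {suc n} σ i with view i
... | ‵fromℕ     = subst₂ _≤_ (sym (inversions-fromℕ σ)) (sym (Fin.toℕ-fromℕ n))
                          (ℕ.m∸n≤m n (toℕ (σ ⟨$⟩ʳ fromℕ n)))
... | ‵inject₁ j = subst₂ _≤_ (sym (inversions-inject₁ σ j)) (sym (Fin.toℕ-inject₁ j))
                          (inversions-≤ (remove (fromℕ n) σ) j)

inversions-injective : ∀ {n} (σ σ′ : Permutation′ n) → (∀ i → inversions σ i ≡ inversions σ′ i) →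
  ∀ i → σ ⟨$⟩ʳ i ≡ σ′ ⟨$⟩ʳ i
inversions-injective {suc n} σ σ′ same = agree
  where
  open ≡-Reasoning
  top = fromℕ n

  same-top : σ ⟨$⟩ʳ top ≡ σ′ ⟨$⟩ʳ top
  same-top = Fin.toℕ-injective (ℕ.∸-cancelˡ-≡ (s≤s⁻¹ (Fin.toℕ<n _)) (s≤s⁻¹ (Fin.toℕ<n _))
    (trans (sym (inversions-fromℕ σ)) (trans (same top) (inversions-fromℕ σ′))))

  same-removed : ∀ j → remove top σ ⟨$⟩ʳ j ≡ remove top σ′ ⟨$⟩ʳ j
  same-removed = inversions-injective (remove top σ) (remove top σ′) λ j →
    trans (sym (inversions-inject₁ σ j)) (trans (same (inject₁ j)) (inversions-inject₁ σ′ j))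

  agree : ∀ i → σ ⟨$⟩ʳ i ≡ σ′ ⟨$⟩ʳ i
  agree i with view i
  ... | ‵fromℕ     = same-top
  ... | ‵inject₁ j = begin
    σ ⟨$⟩ʳ inject₁ j                              ≡⟨ permute-inject₁ σ j ⟩
    punchIn (σ ⟨$⟩ʳ top) (remove top σ ⟨$⟩ʳ j)    ≡⟨ cong₂ punchIn same-top (same-removed j) ⟩
    punchIn (σ′ ⟨$⟩ʳ top) (remove top σ′ ⟨$⟩ʳ j)  ≡⟨ permute-inject₁ σ′ j ⟨
    σ′ ⟨$⟩ʳ inject₁ j                             ∎

inversions-surjective : ∀ {n} (c : Fin n → ℕ) → (∀ i → c i ≤ toℕ i) →
  Σ (Permutation′ n) λ σ → ∀ i → inversions σ i ≡ c i
inversions-surjective {zero}  c _  = id , λ ()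
inversions-surjective {suc n} c c≤ = σ , realises
  where
  open ≡-Reasoning
  top = fromℕ n
  rest = inversions-surjective (c ∘ inject₁) λ j →
    subst (c (inject₁ j) ≤_) (Fin.toℕ-inject₁ j) (c≤ (inject₁ j))
  τ = proj₁ rest
  p<1+n : n ∸ c top < suc n
  p<1+n = s≤s (ℕ.m∸n≤m n (c top))
  p = fromℕ< p<1+n
  σ = insert top p τ

  realises : ∀ i → inversions σ i ≡ c i
  realises i with view i
  ... | ‵fromℕ = begin
    inversions σ top       ≡⟨ inversions-fromℕ σ ⟩
    n ∸ toℕ (σ ⟨$⟩ʳ top)   ≡⟨ cong (λ k → n ∸ toℕ k) (insert-self top p τ) ⟩
    n ∸ toℕ p              ≡⟨ cong (n ∸_) (Fin.toℕ-fromℕ< p<1+n) ⟩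
    n ∸ (n ∸ c top)        ≡⟨ ℕ.m∸[m∸n]≡n (subst (c top ≤_) (Fin.toℕ-fromℕ n) (c≤ top)) ⟩
    c top                  ∎
  ... | ‵inject₁ j = begin
    inversions σ (inject₁ j)     ≡⟨ inversions-inject₁ σ j ⟩
    inversions (remove top σ) j  ≡⟨ inversions-cong {σ = remove top σ} {τ} (remove-insert top p τ) j ⟩
    inversions τ j               ≡⟨ proj₂ rest j ⟩
    c (inject₁ j)                ∎

I≡inversions : ∀ {n} (w : Perm n) i → I w i ≡ inversions (flip w) i
I≡inversions {n} w i =
  length-filter-tabulate (λ j → (j <? i) ×-dec (w ⟨$⟩ˡ i <? w ⟨$⟩ˡ j)) {n} (λ j → j)

I-≤ : ∀ {n} (w : Perm n) i → I w i ≤ toℕ i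
I-≤ w i = subst (_≤ toℕ i) (sym (I≡inversions w i)) (inversions-≤ (flip w) i)

I-injective : ∀ {n} (u u′ : Perm n) → (∀ i → I u i ≡ I u′ i) → u ≈P u′
I-injective u u′ same i = begin
  u ⟨$⟩ʳ i                          ≡⟨ cong (u ⟨$⟩ʳ_) (inverseˡ u′) ⟨
  u ⟨$⟩ʳ (u′ ⟨$⟩ˡ (u′ ⟨$⟩ʳ i))      ≡⟨ cong (u ⟨$⟩ʳ_) (same⁻¹ (u′ ⟨$⟩ʳ i)) ⟨
  u ⟨$⟩ʳ (u ⟨$⟩ˡ (u′ ⟨$⟩ʳ i))       ≡⟨ inverseʳ u ⟩
  u′ ⟨$⟩ʳ i                         ∎
  where
  open ≡-Reasoning
  same⁻¹ : ∀ j → u ⟨$⟩ˡ j ≡ u′ ⟨$⟩ˡ j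
  same⁻¹ = inversions-injective (flip u) (flip u′) λ j →
    trans (sym (I≡inversions u j)) (trans (same j) (I≡inversions u′ j))

I-surjective : ∀ {n} (c : Fin n → ℕ) → (∀ i → c i ≤ toℕ i) → Σ (Perm n) λ u → ∀ i → I u i ≡ c i
I-surjective c c≤ with inversions-surjective c c≤
... | σ , σ-realises = flip σ , λ i → trans (I≡inversions (flip σ) i) (σ-realises i)

x∈p─q⇒x∉q : ∀ {n} {x : Fin n} (p q : Subset n) → x ∈ p ─ q → x ∉ q
x∈p─q⇒x∉q (inside ∷ p) (outside ∷ q) here      ()
x∈p─q⇒x∉q (_      ∷ p) (_       ∷ q) (there x) (there x∈q) = x∈p─q⇒x∉q p q x x∈q

incomparable-between : ∀ {n} {A B C : Subset n} → A ⊆ C → ¬ B ⊆ A → ¬ C ⊆ B →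
  Σ (Subset n) λ D → A ⊆ D × D ⊆ C × ¬ D ⊆ B × ¬ B ⊆ D
incomparable-between {A = A} {B} {C} A⊆C B⊈A C⊈B = A ∪ (C ─ B) , p⊆p∪q (C ─ B) , D⊆C , D⊈B , B⊈D
  where
  D⊆C : A ∪ (C ─ B) ⊆ C
  D⊆C x∈D = [ A⊆C , p─q⊆p C B ] (x∈p∪q⁻ A (C ─ B) x∈D)
  D⊈B : ¬ A ∪ (C ─ B) ⊆ B
  D⊈B D⊆B = C⊈B λ {x} x∈C → decidable-stable (x ∈? B) λ x∉B →
    x∉B (D⊆B (q⊆p∪q A (C ─ B) (x∈p∧x∉q⇒x∈p─q x∈C x∉B)))
  B⊈D : ¬ B ⊆ A ∪ (C ─ B)
  B⊈D B⊆D = B⊈A λ x∈B →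
    [ (λ x∈A → x∈A) , (λ x∈C─B → contradiction x∈B (x∈p─q⇒x∉q C B x∈C─B)) ] (x∈p∪q⁻ A (C ─ B) (B⊆D x∈B))

subsetOf : ∀ {n p} {P : Pred (Fin n) p} → Decidable P → Subset n
subsetOf {zero}  P? = []
subsetOf {suc n} P? = does (P? zero) ∷ subsetOf (P? ∘ suc)

∈-subsetOf : ∀ {n p} {P : Pred (Fin n) p} (P? : Decidable P) {i} → i ∈ subsetOf P? ⇔ P i
∈-subsetOf {suc n} P? {zero}  = zero∈⇔ (P? zero)
  where
  zero∈⇔ : ∀ {a} {A : Set a} (a? : Dec A) {xs : Subset n} → zero ∈ does a? ∷ xs ⇔ A
  zero∈⇔ (yes a) = mk⇔ (λ _ → a) (λ _ → here)
  zero∈⇔ (no ¬a) = mk⇔ (λ ()) (λ a → contradiction a ¬a)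
∈-subsetOf {suc n} P? {suc i} =
  mk⇔ (to (∈-subsetOf (P? ∘ suc)) ∘ drop-there) (there ∘ from (∈-subsetOf (P? ∘ suc)))

select : ∀ {n} (p : Subset n) → Subset n → Subset ∣ p ∣
select []            []      = []
select (inside  ∷ p) (b ∷ q) = b ∷ select p q
select (outside ∷ p) (_ ∷ q) = select p q

extend : ∀ {n} (p : Subset n) → Subset ∣ p ∣ → Subset n
extend []            []      = []
extend (inside  ∷ p) (b ∷ s) = b ∷ extend p s
extend (outside ∷ p) s       = outside ∷ extend p s

select-extend : ∀ {n} (p : Subset n) s → select p (extend p s) ≡ s
select-extend []            []      = refl
select-extend (inside  ∷ p) (b ∷ s) = cong (b ∷_) (select-extend p s)
select-extend (outside ∷ p) s       = select-extend p s

extend-⊆ : ∀ {n} (p : Subset n) s → extend p s ⊆ p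
extend-⊆ (inside  ∷ p) (inside ∷ s) here      = here
extend-⊆ (inside  ∷ p) (_      ∷ s) (there x) = there (extend-⊆ p s x)
extend-⊆ (outside ∷ p) s            (there x) = there (extend-⊆ p s x)

select-mono-⊆ : ∀ {n} (p : Subset n) {q r} → q ⊆ r → select p q ⊆ select p r
select-mono-⊆ (inside ∷ p) {inside ∷ q} {c ∷ r} q⊆r here with q⊆r here
... | here = here
select-mono-⊆ (inside  ∷ p) {_ ∷ q} {_ ∷ r} q⊆r (there x) = there (select-mono-⊆ p (drop-∷-⊆ q⊆r) x)
select-mono-⊆ (outside ∷ p) {_ ∷ q} {_ ∷ r} q⊆r x         = select-mono-⊆ p (drop-∷-⊆ q⊆r) x

select-cancel-⊆ : ∀ {n} (p : Subset n) {q r} → q ⊆ p → select p q ⊆ select p r → q ⊆ r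
select-cancel-⊆ (inside ∷ p) {inside ∷ q} {c ∷ r} _ sel⊆ here with sel⊆ here
... | here = here
select-cancel-⊆ (outside ∷ p) q⊆p _ here with q⊆p here
... | ()
select-cancel-⊆ (inside  ∷ p) {_ ∷ q} {_ ∷ r} q⊆p sel⊆ (there x) =
  there (select-cancel-⊆ p (drop-∷-⊆ q⊆p) (drop-∷-⊆ sel⊆) x)
select-cancel-⊆ (outside ∷ p) {_ ∷ q} {_ ∷ r} q⊆p sel⊆ (there x) =
  there (select-cancel-⊆ p (drop-∷-⊆ q⊆p) sel⊆ x)

n≡m⊎n≡1+m : ∀ {m n} → m ≤ n → n ≤ suc m → n ≡ m ⊎ n ≡ suc m
n≡m⊎n≡1+m m≤n n≤1+m with ℕ.m≤n⇒m<n∨m≡n m≤n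
... | inj₁ m<n = inj₂ (ℕ.≤-antisym n≤1+m m<n)
... | inj₂ m≡n = inj₁ (sym m≡n)

≤-updateAt : ∀ {n} (x : Fin n → ℕ) i {f : ℕ → ℕ} → x i ≤ f (x i) → Pointwise _≤_ x (updateAt x i f)
≤-updateAt x i x≤fx j with j Fin.≟ i
... | yes refl = subst (x j ≤_) (sym (updateAt-updates j x)) x≤fx
... | no  j≢i  = ℕ.≤-reflexive (sym (updateAt-minimal j i x j≢i))

updateAt-≤ : ∀ {n} {x y : Fin n → ℕ} i {f : ℕ → ℕ} → Pointwise _≤_ x y → f (x i) ≤ y i →
  Pointwise _≤_ (updateAt x i f) y
updateAt-≤ {x = x} {y} i x≤y fx≤y j with j Fin.≟ i
... | yes refl = subst (_≤ y j) (sym (updateAt-updates j x)) fx≤y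
... | no  j≢i  = subst (_≤ y j) (sym (updateAt-minimal j i x j≢i)) (x≤y j)

comparable-within-two-steps : ∀ {n} {x z : Fin n → ℕ} i →
  Pointwise _≤_ x z → Pointwise _≤_ z (updateAt x i (2 +_)) →
  Pointwise _≤_ z (updateAt x i suc) ⊎ Pointwise _≤_ (updateAt x i suc) z
comparable-within-two-steps {x = x} {z} i x≤z z≤x+2 with z i ℕ.≤? suc (x i)
... | no  zᵢ≰ = inj₂ (updateAt-≤ i x≤z (ℕ.<⇒≤ (ℕ.≰⇒> zᵢ≰)))
... | yes zᵢ≤ = inj₁ z≤x+1
  where
  z≤x+1 : Pointwise _≤_ z (updateAt x i suc)
  z≤x+1 j with j Fin.≟ i
  ... | yes refl = subst (z j ≤_) (sym (updateAt-updates j x)) zᵢ≤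
  ... | no  j≢i  = subst (z j ≤_) (trans (updateAt-minimal j i x j≢i) (sym (updateAt-minimal j i x j≢i)))
                         (z≤x+2 j)

-- Intervals of the middle order

interval-element : ∀ {n} {v w : Perm n} (c : Fin n → ℕ) → Pointwise _≤_ (I v) c → Pointwise _≤_ c (I w) →
  Σ (Interval v w) λ a → ∀ i → I (proj₁ a) i ≡ c i
interval-element {w = w} c v≤c c≤w with I-surjective c (λ i → ℕ.≤-trans (c≤w i) (I-≤ w i))
... | u , u-realises = (u , v≤u , u≤w) , u-realises
  where
  v≤u : Pointwise _≤_ _ (I u)
  v≤u i = subst (_ ≤_) (sym (u-realises i)) (v≤c i)
  u≤w : Pointwise _≤_ (I u) (I w)
  u≤w i = subst (_≤ I w i) (sym (u-realises i)) (c≤w i)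

module _ {n} {v w : Perm n} where

  _≤ᴵ_ : Interval v w → Interval v w → Set
  a ≤ᴵ b = proj₁ a ≤M proj₁ b

  boolean⇒incomparable-between : IsBoolean v w → (a b c : Interval v w) →
    a ≤ᴵ c → ¬ b ≤ᴵ a → ¬ c ≤ᴵ b → Σ (Interval v w) λ d → a ≤ᴵ d × d ≤ᴵ c × ¬ d ≤ᴵ b × ¬ b ≤ᴵ d
  boolean⇒incomparable-between (_ , f , iso) a b c a≤c b≰a c≰b =
    d , from (order a d) (subst (f a ⊆_) (sym fd≡D) A⊆D)
      , from (order d c) (subst (_⊆ f c) (sym fd≡D) D⊆C)
      , D⊈B ∘ subst (_⊆ f b) fd≡D ∘ to (order d b)
      , B⊈D ∘ subst (f b ⊆_) fd≡D ∘ to (order b d)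
    where
    open IsBoolIso iso
    between = incomparable-between (to (order a c) a≤c) (b≰a ∘ from (order b a)) (c≰b ∘ from (order c b))
    D   = proj₁ between
    A⊆D = proj₁ (proj₂ between)
    D⊆C = proj₁ (proj₂ (proj₂ between))
    D⊈B = proj₁ (proj₂ (proj₂ (proj₂ between)))
    B⊈D = proj₂ (proj₂ (proj₂ (proj₂ between)))
    d    = proj₁ (surjective D)
    fd≡D = proj₂ (surjective D)

  boolean⇒unit-steps : v ≤M w → IsBoolean v w → ∀ i → I w i ≡ I v i ⊎ I w i ≡ suc (I v i)
  boolean⇒unit-steps v≤w boolean i = n≡m⊎n≡1+m (v≤w i) (ℕ.≮⇒≥ no-double-step)
    where
    x = I v
    no-double-step : ¬ suc (x i) < I w i
    no-double-step 2+x≤y = contradiction d-vs-b [ d≰b , b≰d ]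
      where
      one = interval-element {v = v} {w} (updateAt x i suc)
              (≤-updateAt x i (ℕ.n≤1+n _)) (updateAt-≤ i v≤w (ℕ.<⇒≤ 2+x≤y))
      two = interval-element {v = v} {w} (updateAt x i (2 +_))
              (≤-updateAt x i (ℕ.m≤n+m _ 2)) (updateAt-≤ i v≤w 2+x≤y)
      a b c : Interval v w
      a = v , (λ _ → ℕ.≤-refl) , v≤w
      b = proj₁ one
      c = proj₁ two
      bᵢ≡ : I (proj₁ b) i ≡ suc (x i)
      bᵢ≡ = trans (proj₂ one i) (updateAt-updates i x)
      b≰a : ¬ b ≤ᴵ a
      b≰a b≤a = ℕ.1+n≰n (subst (_≤ x i) bᵢ≡ (b≤a i))
      c≰b : ¬ c ≤ᴵ b
      c≰b c≤b = ℕ.1+n≰n (subst₂ _≤_ (trans (proj₂ two i) (updateAt-updates i x)) bᵢ≡ (c≤b i))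
      between = boolean⇒incomparable-between boolean a b c (proj₁ (proj₂ c)) b≰a c≰b
      d   = proj₁ between
      d≤c = proj₁ (proj₂ (proj₂ between))
      d≰b = proj₁ (proj₂ (proj₂ (proj₂ between)))
      b≰d = proj₂ (proj₂ (proj₂ (proj₂ between)))
      d-vs-b : d ≤ᴵ b ⊎ b ≤ᴵ d
      d-vs-b = Sum.map (λ d≤ j → subst (I (proj₁ d) j ≤_) (sym (proj₂ one j)) (d≤ j))
                       (λ ≤d j → subst (_≤ I (proj₁ d) j) (sym (proj₂ one j)) (≤d j))
        (comparable-within-two-steps i (proj₁ (proj₂ d)) λ j →
          subst (I (proj₁ d) j ≤_) (proj₂ two j) (d≤c j))

module _ {n} {v w : Perm n} (v≤w : v ≤M w) (steps : ∀ i → I w i ≡ I v i ⊎ I w i ≡ suc (I v i)) where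
  private
    x = I v

    w≤1+v : ∀ i → I w i ≤ suc (x i)
    w≤1+v i = [ (λ wᵢ≡ → ℕ.≤-trans (ℕ.≤-reflexive wᵢ≡) (ℕ.n≤1+n (x i))) , ℕ.≤-reflexive ]′ (steps i)

  raised : Perm n → Subset n
  raised u = subsetOf (λ i → I u i ℕ.≟ suc (x i))

  ∈-raised : ∀ u {i} → i ∈ raised u ⇔ I u i ≡ suc (x i)
  ∈-raised u = ∈-subsetOf (λ i → I u i ℕ.≟ suc (x i))

  raised-⊆ : (a : Interval v w) → raised (proj₁ a) ⊆ raised w
  raised-⊆ (u , _ , u≤w) {i} i∈ = from (∈-raised w)
    (ℕ.≤-antisym (w≤1+v i) (subst (_≤ I w i) (to (∈-raised u) i∈) (u≤w i)))

  ≤M⇔raised-⊆ : (a b : Interval v w) → proj₁ a ≤M proj₁ b ⇔ raised (proj₁ a) ⊆ raised (proj₁ b)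
  ≤M⇔raised-⊆ (u , v≤u , u≤w) (u′ , v≤u′ , u′≤w) = mk⇔ mono reflects
    where
    mono : u ≤M u′ → raised u ⊆ raised u′
    mono u≤u′ {i} i∈ = from (∈-raised u′)
      (ℕ.≤-antisym (ℕ.≤-trans (u′≤w i) (w≤1+v i)) (subst (_≤ I u′ i) (to (∈-raised u) i∈) (u≤u′ i)))
    reflects : raised u ⊆ raised u′ → u ≤M u′
    reflects ⊆′ i with I u i ℕ.≟ suc (x i)
    ... | yes uᵢ≡ = ℕ.≤-reflexive (trans uᵢ≡ (sym (to (∈-raised u′) (⊆′ (from (∈-raised u) uᵢ≡)))))
    ... | no  uᵢ≢ = [ (λ uᵢ≡ → subst (_≤ I u′ i) (sym uᵢ≡) (v≤u′ i)) , (λ uᵢ≡ → contradiction uᵢ≡ uᵢ≢) ]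
                      (n≡m⊎n≡1+m (v≤u i) (ℕ.≤-trans (u≤w i) (w≤1+v i)))

  raise : Subset n → Fin n → ℕ
  raise q i = if does (i ∈? q) then suc (x i) else x i

  x≤raise : ∀ q i → x i ≤ raise q i
  x≤raise q i with i ∈? q
  ... | yes _ = ℕ.n≤1+n (x i)
  ... | no  _ = ℕ.≤-refl

  raise-∈ : ∀ {q i} → i ∈ q → raise q i ≡ suc (x i)
  raise-∈ {q} {i} i∈q = cong (if_then suc (x i) else x i) (dec-true (i ∈? q) i∈q)

  raise-∉ : ∀ {q i} → i ∉ q → raise q i ≡ x i
  raise-∉ {q} {i} i∉q = cong (if_then suc (x i) else x i) (dec-false (i ∈? q) i∉q)

  raise≤w : ∀ {q} → q ⊆ raised w → ∀ i → raise q i ≤ I w i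
  raise≤w {q} q⊆ i with i ∈? q
  ... | yes i∈q = ℕ.≤-reflexive (sym (to (∈-raised w) (q⊆ i∈q)))
  ... | no  _   = v≤w i

  raised-raise : ∀ (u : Perm n) q → (∀ i → I u i ≡ raise q i) → raised u ≡ q
  raised-raise u q u≡ = ⊆-antisym raised⊆q q⊆raised
    where
    raised⊆q : raised u ⊆ q
    raised⊆q {i} i∈ = decidable-stable (i ∈? q) λ i∉q →
      ℕ.1+n≢n (trans (sym (to (∈-raised u) i∈)) (trans (u≡ i) (raise-∉ i∉q)))
    q⊆raised : q ⊆ raised u
    q⊆raised {i} i∈q = from (∈-raised u) (trans (u≡ i) (raise-∈ i∈q))

  unit-steps⇒boolean : IsBoolean v w
  unit-steps⇒boolean = ∣ raised w ∣ , f , record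
    { injective  = λ a b fa≡fb → I-injective (proj₁ a) (proj₁ b) λ i → ℕ.≤-antisym
        (from (order a b) (⊆-reflexive fa≡fb) i) (from (order b a) (⊆-reflexive (sym fa≡fb)) i)
    ; surjective = surjective
    ; order      = order
    }
    where
    f : Interval v w → Subset ∣ raised w ∣
    f a = select (raised w) (raised (proj₁ a))

    order : ∀ a b → proj₁ a ≤M proj₁ b ⇔ f a ⊆ f b
    order a b = ⇔.trans (≤M⇔raised-⊆ a b)
      (mk⇔ (select-mono-⊆ (raised w)) (select-cancel-⊆ (raised w) (raised-⊆ a)))

    surjective : ∀ s → Σ (Interval v w) λ a → f a ≡ s
    surjective s = proj₁ element , (begin
      f (proj₁ element)    ≡⟨ cong (select (raised w)) (raised-raise u q (proj₂ element)) ⟩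
      select (raised w) q  ≡⟨ select-extend (raised w) s ⟩
      s                    ∎)
      where
      open ≡-Reasoning
      q = extend (raised w) s
      element = interval-element {v = v} {w} (raise q) (x≤raise q) (raise≤w (extend-⊆ (raised w) s))
      u = proj₁ (proj₁ element)

-- Ranks

sum-map-steps : ∀ {a} {A : Set a} (x y : A → ℕ) → (∀ a → y a ≡ x a ⊎ y a ≡ suc (x a)) → ∀ l →
  sum (map y l) ≡ sum (map x l) + length (filter (λ a → y a ℕ.≟ suc (x a)) l)
sum-map-steps x y steps []      = refl
sum-map-steps x y steps (a ∷ l) with steps a
... | inj₁ y≡x = begin
  y a + sum (map y l)        ≡⟨ cong₂ _+_ y≡x (sum-map-steps x y steps l) ⟩
  x a + (sum (map x l) + L)  ≡⟨ ℕ.+-assoc (x a) _ L ⟨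
  x a + sum (map x l) + L    ≡⟨ cong (λ l′ → x a + sum (map x l) + length l′)
                                     (filter-reject P? not-raised) ⟨
  x a + sum (map x l) + length (filter P? (a ∷ l)) ∎
  where
  open ≡-Reasoning
  P? = λ a → y a ℕ.≟ suc (x a)
  L = length (filter P? l)
  not-raised : y a ≢ suc (x a)
  not-raised y≡1+x = ℕ.1+n≢n (trans (sym y≡1+x) y≡x)
... | inj₂ y≡1+x = begin
  y a + sum (map y l)              ≡⟨ cong₂ _+_ y≡1+x (sum-map-steps x y steps l) ⟩
  suc (x a + (sum (map x l) + L))  ≡⟨ cong suc (ℕ.+-assoc (x a) _ L) ⟨
  suc (x a + sum (map x l) + L)    ≡⟨ ℕ.+-suc _ L ⟨
  x a + sum (map x l) + suc L      ≡⟨ cong (λ l′ → x a + sum (map x l) + length l′)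
                                           (filter-accept P? y≡1+x) ⟨
  x a + sum (map x l) + length (filter P? (a ∷ l)) ∎
  where
  open ≡-Reasoning
  P? = λ a → y a ℕ.≟ suc (x a)
  L = length (filter P? l)

intervalRank≡numUp : ∀ {n} (v w : Perm n) → (∀ i → I w i ≡ I v i ⊎ I w i ≡ suc (I v i)) →
  intervalRank v w ≡ numUp v w
intervalRank≡numUp {n} v w steps =
  trans (cong (_∸ rank v) (sum-map-steps (I v) (I w) steps (allFin n))) (ℕ.m+n∸m≡n (rank v) _)

numUp≤n∸1 : ∀ {n} (v w : Perm n) → numUp v w ≤ n ∸ 1
numUp≤n∸1 {zero}  v w = z≤n
numUp≤n∸1 {suc n} v w = begin
  length (filter P? (allFin (suc n)))
    ≡⟨ cong length (filter-reject P? {x = zero} {xs = tabulate suc} zero-not-raised) ⟩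
  length (filter P? (tabulate suc))    ≤⟨ length-filter P? (tabulate suc) ⟩
  length (tabulate {n = n} suc)        ≡⟨ length-tabulate suc ⟩
  n                                    ∎
  where
  open ℕ.≤-Reasoning
  P? : Decidable λ i → I w i ≡ suc (I v i)
  P? i = I w i ℕ.≟ suc (I v i)
  zero-not-raised : I w zero ≢ suc (I v zero)
  zero-not-raised w₀≡ with () ← subst (_≤ 0) w₀≡ (I-≤ w zero)

lemma3p6 : ∀ (n : ℕ) (v w : Perm n) → v ≤M w →
    (IsBoolean v w ⇔ (∀ i → I w i ≡ I v i ⊎ I w i ≡ suc (I v i)))
    × (IsBoolean v w → ∀ (k : ℕ) → (intervalRank v w ≡ k ⇔ numUp v w ≡ k))
    × (IsBoolean v w → intervalRank v w ≤ n ∸ 1)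
lemma3p6 n v w v≤w =
  mk⇔ (boolean⇒unit-steps v≤w) (unit-steps⇒boolean v≤w) ,
  (λ boolean k → mk⇔ (trans (sym (rank≡numUp boolean))) (trans (rank≡numUp boolean))) ,
  (λ boolean → ℕ.≤-trans (ℕ.≤-reflexive (rank≡numUp boolean)) (numUp≤n∸1 v w))
  where
  rank≡numUp : IsBoolean v w → intervalRank v w ≡ numUp v w
  rank≡numUp = intervalRank≡numUp v w ∘ boolean⇒unit-steps v≤w
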